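{- Let $d=0.1\log_3 n$ and, for $k=1,\dots,d$, let $N_k=n^{0.1}3^{k-1}$ and $V_k=\{v_{k,0},v_{k,1},\dots,v_{k,N_k-1}\}$, disjoint sets of vertices of a graph $G$ on $n$ vertices, where the edges of $G$ among $\bigcup_kV_k$ are exactly all pairs $(u,v)$ with $u\in V_1$ and $v\in\bigcup_{k=2}^dV_k$. Let $H=B_1\circ B_2\circ\cdots\circ B_{5n/d}$ (concatenation), where $B_i=(v_{1,\,i\bmod N_1},v_{2,\,i\bmod N_2},\dots,v_{d,\,i\bmod N_d})$. Then for every substring $S$ of $H$, $\dfrac{\mathrm{rank}(S)}{\mathrm{len}(S)}=O\!\left(\dfrac{1}{\log n}\right)$.
   Context: A substring of $H=(\sigma_1,\dots,\sigma_k)$ is $(\sigma_i,\dots,\sigma_j)$. For a sequence $S=(\sigma_1,\dots,\sigma_k)$ of nodes, an arc is a pair $\alpha=(i,j)$ with $i<j$, $\sigma_i=\sigma_j$, $\sigma_l\ne\sigma_i$ for $i<l<j$, and $\mathrm{node}(\alpha)=\sigma_i$. Using the configuration $\gamma_0\equiv-1$ on the nodes of $S$ and $\gamma_i$ obtained from $\gamma_{i-1}$ by flipping the sign at $\sigma_i$, the improvement vector of $\alpha=(i,j)$ is the vector in $\{ -2,0,2\}^E$ whose entry at $e$ is nonzero iff $e=(\mathrm{node}(\alpha),v)$ for a node $v$ appearing an odd number of times among $\sigma_{i+1},\dots,\sigma_{j-1}$, in which case it equals $2\gamma_{i-1}(\mathrm{node}(\alpha))\gamma_{i-1}(v)$.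 $\mathrm{rank}(S)$ is the rank of the set of improvement vectors of all arcs of $S$. -}

module Defs where

open import Data.Nat using (ℕ; zero; suc; _+_; _*_; _∸_; _^_; _≤_; _<_; _≤ᵇ_; _≡ᵇ_; _%_; _/_)
open import Data.Bool using (Bool; true; false; if_then_else_; _∧_)
open import Data.List using (List; []; _∷_; length; map; take; drop; upTo; concatMap; lookup)
open import Data.Fin using (Fin; toℕ)
open import Data.Product using (Σ; _×_; _,_; proj₁; proj₂; ∃-syntax)
open import Data.Rational using (ℚ; 0ℚ; 1ℚ; -_; _+_; _*_)
open import Data.List.Relation.Unary.All using (All)
open import Relation.Binary.PropositionalEquality using (_≡_; _≢_)

countB : {A : Set} → (A → Bool) → List A → ℕ
countB p [] = 0
countB p (x ∷ xs) = if p x then suc (countB p xs) else countB p xs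

-- d n = ⌊ 0.1 log₃ n ⌋ = number of j ∈ {1..n} with 3^(10 j) ≤ n
dP : ℕ → ℕ
dP n = countB (λ j → 3 ^ (10 Data.Nat.* j) ≤ᵇ n) (map suc (upTo n))

-- ⌊ n^0.1 ⌋ = (number of x ∈ {0..n} with x^10 ≤ n) - 1
root10 : ℕ → ℕ
root10 n = countB (λ x → x ^ 10 ≤ᵇ n) (upTo (suc n)) ∸ 1

NP : ℕ → ℕ → ℕ
NP n k = root10 n Data.Nat.* 3 ^ (k ∸ 1)

-- i mod m (with the convention i mod 0 = 0; irrelevant for large n)
modP : ℕ → ℕ → ℕ
modP i zero = 0
modP i (suc m) = i % suc m

nBlocks : ℕ → ℕ
nBlocks n with dP n
... | zero = 0
... | suc e = (5 Data.Nat.* n) / suc e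

-- vertices: v_{k,i} is the pair (k , i)
Vtx : Set
Vtx = ℕ × ℕ

_==_ : Vtx → Vtx → Bool
(a , b) == (c , e) = (a ≡ᵇ c) ∧ (b ≡ᵇ e)

block : ℕ → ℕ → List Vtx
block n i = map (λ k → (k , modP i (NP n k))) (map suc (upTo (dP n)))

H : ℕ → List Vtx
H n = concatMap (block n) (map suc (upTo (nBlocks n)))

-- edges of G among ⋃ V_k, oriented canonically as (u , v) with
-- u ∈ V_1 and v ∈ V_k for some 2 ≤ k ≤ d
isEdge : ℕ → Vtx → Vtx → Bool
isEdge n (k , i) (k' , i') =
  (k ≡ᵇ 1) ∧ ((suc i ≤ᵇ NP n 1) ∧ ((2 ≤ᵇ k') ∧ ((k' ≤ᵇ dP n) ∧ (suc i' ≤ᵇ NP n k'))))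

record Arc (S : List Vtx) : Set where
  field
    i j : Fin (length S)
    i<j : toℕ i < toℕ j
    same : lookup S i ≡ lookup S j
    noneBetween : (l : Fin (length S)) → toℕ i < toℕ l → toℕ l < toℕ j →
                  lookup S l ≢ lookup S i

odd : ℕ → Bool
odd c = c % 2 ≡ᵇ 1

-- γ(x) for the configuration after flipping the entries of a prefix,
-- starting from γ₀ ≡ -1
γ : List Vtx → Vtx → ℚ
γ pre x = if odd (countB (_== x) pre) then 1ℚ else - 1ℚ

two : ℚ
two = 1ℚ Data.Rational.+ 1ℚ

-- improvement vector of an arc; coordinate (u , v) stands for the edge {u , v}
-- with u ∈ V_1 (see isEdge); non-edge coordinates are 0
impVec : ℕ → (S : List Vtx) → Arc S → Vtx → Vtx → ℚ
impVec n S α u v =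
  if isEdge n u v
  then (if (x == u) ∧ odd (countB (_== v) mid) then val
        else if (x == v) ∧ odd (countB (_== u) mid) then val
        else 0ℚ)
  else 0ℚ
  where
    open Arc α
    x = lookup S i
    mid = take (toℕ j ∸ suc (toℕ i)) (drop (suc (toℕ i)) S)
    pre = take (toℕ i) S       -- σ_1 … σ_{i-1} in 1-indexed notation
    val = two Data.Rational.* (γ pre u Data.Rational.* γ pre v)

lincomb : List ℚ → List (Vtx → Vtx → ℚ) → Vtx → Vtx → ℚ
lincomb (c ∷ cs) (w ∷ ws) u v = c Data.Rational.* w u v Data.Rational.+ lincomb cs ws u v
lincomb _ _ u v = 0ℚ

LinIndep : List (Vtx → Vtx → ℚ) → Set
LinIndep ws = (cs : List ℚ) → length cs ≡ length ws →
              ((u v : Vtx) → lincomb cs ws u v ≡ 0ℚ) → All (_≡ 0ℚ) cs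

IsRank : ℕ → List Vtx → ℕ → Set
IsRank n S r =
  (Σ (List (Arc S)) λ L → length L ≡ r × LinIndep (map (impVec n S) L)) ×
  ((L : List (Arc S)) → LinIndep (map (impVec n S) L) → length L ≤ r)

module Submission where

-- Write d = dP n and N_k = NP n k = ⌊n^0.1⌋·3^(k-1). Position p = b·d + r (0 ≤ r < d) of H carries
-- v_{r+1, (b+1) mod N_{r+1}}, so the vertex at p recurs exactly every period(p) = N_{r+1}·d positions
-- and an arc starting at p ends at p + period(p). Hence the improvement vector of an arc depends only on
-- its start (arcVector). For a node x outside V_1 it does not even depend on which occurrence of x the
-- arc starts at: every coordinate is an edge (u , x) with u ∈ V_1, moving the start by t periods keeps
-- the interior count of u and adds t·3^(k-1) occurrences of u and t of x to the prefix, which preserves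
-- γ(u)·γ(x) since 3^(k-1) is odd (arcVector-shift). With q = ⌊ℓ/d⌋, arcs at V_1 nodes start in one of
-- q + 2 blocks, and an arc at v_{k,i} (k ≥ 2) needs N_k·d < ℓ, so N_k ≤ q and the code N_k + i < 2q
-- determines the node. So fewer than 3q + 4 distinct vectors occur, and by pigeonhole rank·d ≤ 7ℓ
-- (rank·d≤). Finally log₂ n ≤ 16(d + 1) ≤ 32d.

open import Defs
open import Data.Nat as N using (ℕ; zero; suc; _+_; _*_; _∸_; _<_; _≤_; _^_; _%_; _/_; NonZero; z≤n; s≤s; _≡ᵇ_; _≤ᵇ_)
open import Data.Nat.Properties
open import Data.Nat.DivMod
open import Data.Nat.Divisibility.Core using (divides)
open import Data.Nat.Logarithm using (⌊log₂_⌋; ⌊log₂⌋-mono-≤; ⌊log₂[2^n]⌋≡n)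
open import Data.Nat.Tactic.RingSolver using (solve-∀)
open import Data.Bool using (Bool; true; false; if_then_else_; _∧_; not; _xor_; T)
open import Data.List as L using (List; []; _∷_; map; _++_; lookup; upTo; length; take; drop; concat)
open import Data.List.Properties using (map-upTo; map-++)
open import Data.List.Relation.Unary.All using (_∷_)
open import Data.Fin as F using (Fin; toℕ; fromℕ<)
open import Data.Fin.Properties using (toℕ-fromℕ<; toℕ<n; pigeonhole)
open import Data.Product using (Σ; _×_; _,_; proj₁; proj₂; ∃-syntax)
open import Data.Sum using (_⊎_; inj₁; inj₂)
open import Data.Empty using (⊥; ⊥-elim)
open import Relation.Nullary using (yes; no)
open import Relation.Binary.PropositionalEquality
open import Relation.Binary.Definitions using (tri<; tri≈; tri>)
open import Data.Rational as Q using (ℚ; 0ℚ; 1ℚ; -_)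
import Data.Rational.Properties as QP

-- H and its substrings will be described as maps over ranges of positions;
-- range a m = a , a+1 , … , a+m-1.
range : ℕ → ℕ → List ℕ
range a zero = []
range a (suc m) = a ∷ range (suc a) m

range-++ : ∀ a m k → range a (m + k) ≡ range a m ++ range (a + m) k
range-++ a zero k = cong (λ x → range x k) (sym (+-identityʳ a))
range-++ a (suc m) k =
  cong (a ∷_) (trans (range-++ (suc a) m k) (cong (λ x → range (suc a) m ++ range x k) (sym (+-suc a m))))

map-suc-range : ∀ a m → map suc (range a m) ≡ range (suc a) m
map-suc-range a zero = refl
map-suc-range a (suc m) = cong (suc a ∷_) (map-suc-range (suc a) m)

upTo≡range : ∀ m → upTo m ≡ range 0 m
upTo≡range zero = refl
upTo≡range (suc m) = cong (0 ∷_) (begin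
    L.applyUpTo suc m  ≡⟨ sym (map-upTo suc m) ⟩
    map suc (upTo m)   ≡⟨ cong (map suc) (upTo≡range m) ⟩
    map suc (range 0 m) ≡⟨ map-suc-range 0 m ⟩
    range 1 m          ∎)
  where open ≡-Reasoning

map-range-cong : ∀ {A : Set} (f g : ℕ → A) a b m → (∀ r → r < m → f (a + r) ≡ g (b + r)) →
                 map f (range a m) ≡ map g (range b m)
map-range-cong f g a b zero eq = refl
map-range-cong f g a b (suc m) eq =
  cong₂ _∷_ (subst₂ (λ x y → f x ≡ g y) (+-identityʳ a) (+-identityʳ b) (eq 0 (s≤s z≤n)))
            (map-range-cong f g (suc a) (suc b) m
              (λ r r<m → subst₂ (λ x y → f x ≡ g y) (+-suc a r) (+-suc b r) (eq (suc r) (s≤s r<m))))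

drop-map-range : ∀ {A : Set} (f : ℕ → A) a m k → drop k (map f (range a m)) ≡ map f (range (a + k) (m ∸ k))
drop-map-range f a m zero = cong (λ x → map f (range x m)) (sym (+-identityʳ a))
drop-map-range f a zero (suc k) = refl
drop-map-range f a (suc m) (suc k) =
  trans (drop-map-range f (suc a) m k) (cong (λ x → map f (range x (m ∸ k))) (sym (+-suc a k)))

take-map-range : ∀ {A : Set} (f : ℕ → A) a m k → k ≤ m → take k (map f (range a m)) ≡ map f (range a k)
take-map-range f a m zero _ = refl
take-map-range f a (suc m) (suc k) (s≤s k≤m) = cong (f a ∷_) (take-map-range f (suc a) m k k≤m)

length-map-range : ∀ {A : Set} (f : ℕ → A) a m → length (map f (range a m)) ≡ m
length-map-range f a zero = refl
length-map-range f a (suc m) = cong suc (length-map-range f (suc a) m)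

lookup-map-range : ∀ {A : Set} (f : ℕ → A) a m (q : Fin (length (map f (range a m)))) →
                   lookup (map f (range a m)) q ≡ f (a + toℕ q)
lookup-map-range f a (suc m) F.zero = cong f (sym (+-identityʳ a))
lookup-map-range f a (suc m) (F.suc q) = trans (lookup-map-range f (suc a) m q) (cong f (sym (+-suc a (toℕ q))))

b2n : Bool → ℕ
b2n true = 1
b2n false = 0

countB-∷ : ∀ {A : Set} (p : A → Bool) x xs → countB p (x ∷ xs) ≡ b2n (p x) + countB p xs
countB-∷ p x xs with p x
... | true = refl
... | false = refl

countB-map : ∀ {A B : Set} (p : B → Bool) (f : A → B) xs → countB p (map f xs) ≡ countB (λ x → p (f x)) xs
countB-map p f [] = refl
countB-map p f (x ∷ xs) with p (f x)
... | true = cong suc (countB-map p f xs)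
... | false = countB-map p f xs

countB-++ : ∀ {A : Set} (p : A → Bool) xs ys → countB p (xs ++ ys) ≡ countB p xs + countB p ys
countB-++ p [] ys = refl
countB-++ p (x ∷ xs) ys with p x
... | true = cong suc (countB-++ p xs ys)
... | false = countB-++ p xs ys

countR : (ℕ → Bool) → ℕ → ℕ → ℕ
countR f a m = countB f (range a m)

countR-++ : ∀ f a m k → countR f a (m + k) ≡ countR f a m + countR f (a + m) k
countR-++ f a m k = trans (cong (countB f) (range-++ a m k)) (countB-++ f (range a m) (range (a + m) k))

countR-slide : ∀ f a w → b2n (f a) + countR f (suc a) w ≡ countR f a w + b2n (f (a + w))
countR-slide f a w = begin
    b2n (f a) + countR f (suc a) w    ≡⟨ sym (countB-∷ f a (range (suc a) w)) ⟩
    countR f a (suc w)                ≡⟨ cong (countR f a) (+-comm 1 w) ⟩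
    countR f a (w + 1)                ≡⟨ countR-++ f a w 1 ⟩
    countR f a w + countR f (a + w) 1 ≡⟨ cong (countR f a w +_) (trans (countB-∷ f (a + w) []) (+-identityʳ _)) ⟩
    countR f a w + b2n (f (a + w))    ∎
  where open ≡-Reasoning

Periodic : (ℕ → Bool) → ℕ → Set
Periodic f w = ∀ p → f (p + w) ≡ f p

periodic-multiple : ∀ {f w} → Periodic f w → ∀ c → Periodic f (c * w)
periodic-multiple {f} {w} per zero p = cong f (+-identityʳ p)
periodic-multiple {f} {w} per (suc c) p =
  trans (cong f (sym (+-assoc p w (c * w)))) (trans (periodic-multiple per c (p + w)) (per p))

countR-shift : ∀ {f w} → Periodic f w → ∀ a m → countR f (a + w) m ≡ countR f a m
countR-shift per a zero = refl
countR-shift {f} per a (suc m) rewrite per a | countR-shift {f} per (suc a) m = refl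

countR-window : ∀ {f w} → Periodic f w → ∀ a → countR f a w ≡ countR f 0 w
countR-window per zero = refl
countR-window {f} {w} per (suc a) = trans (+-cancelˡ-≡ (b2n (f a)) _ _ slide) (countR-window per a)
  where
    slide : b2n (f a) + countR f (suc a) w ≡ b2n (f a) + countR f a w
    slide = trans (countR-slide f a w) (trans (cong (λ b → countR f a w + b2n b) (per a)) (+-comm (countR f a w) _))

countR-none : ∀ f b m → (∀ p → b ≤ p → p < b + m → f p ≡ false) → countR f b m ≡ 0
countR-none f b zero h = refl
countR-none f b (suc m) h rewrite h b ≤-refl (m<m+n b (s≤s z≤n)) =
  countR-none f (suc b) m (λ p b<p p< → h p (<⇒≤ b<p) (subst (p <_) (sym (+-suc b m)) p<))

countR-single : ∀ f a m → f a ≡ true → (∀ p → a < p → p < a + suc m → f p ≡ false) → countR f a (suc m) ≡ 1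
countR-single f a m fa h rewrite fa =
  cong suc (countR-none f (suc a) m (λ p a<p p< → h p a<p (subst (p <_) (sym (+-suc a m)) p<)))

countR-all : ∀ f a m → (∀ p → a ≤ p → p < a + m → f p ≡ true) → countR f a m ≡ m
countR-all f a zero h = refl
countR-all f a (suc m) h rewrite h a ≤-refl (m<m+n a (s≤s z≤n)) =
  cong suc (countR-all f (suc a) m (λ p a<p p< → h p (<⇒≤ a<p) (subst (p <_) (sym (+-suc a m)) p<)))

countR-windows : ∀ f w → (∀ a → countR f a w ≡ 1) → ∀ c a → countR f a (c * w) ≡ c
countR-windows f w one zero a = refl
countR-windows f w one (suc c) a =
  trans (countR-++ f a w (c * w)) (cong₂ _+_ (one a) (countR-windows f w one c (a + w)))

par : ℕ → Bool
par zero = false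
par (suc m) = not (par m)

odd≡par : ∀ m → odd m ≡ par m
odd≡par zero = refl
odd≡par (suc zero) = refl
odd≡par (suc (suc m)) =
  trans (cong (N._≡ᵇ 1) (trans (cong (N._% 2) (+-comm 2 m)) ([m+n]%n≡m%n m 2)))
        (trans (odd≡par m) (sym (not-not (par m))))
  where
    not-not : ∀ b → not (not b) ≡ b
    not-not true = refl
    not-not false = refl

par-+ : ∀ a b → par (a + b) ≡ par a xor par b
par-+ zero b = refl
par-+ (suc a) b = trans (cong not (par-+ a b)) (not-xor (par a) (par b))
  where
    not-xor : ∀ x y → not (x xor y) ≡ not x xor y
    not-xor true true = refl
    not-xor true false = refl
    not-xor false y = refl

par-* : ∀ a b → par (a * b) ≡ par a ∧ par b
par-* zero b = refl
par-* (suc a) b = trans (par-+ b (a * b)) (trans (cong (par b xor_) (par-* a b)) (lem (par a) (par b)))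
  where
    lem : ∀ x y → y xor (x ∧ y) ≡ not x ∧ y
    lem true true = refl
    lem true false = refl
    lem false true = refl
    lem false false = refl

par-3^ : ∀ e → par (3 ^ e) ≡ true
par-3^ zero = refl
par-3^ (suc e) = trans (par-* 3 (3 ^ e)) (cong (true ∧_) (par-3^ e))

sign : Bool → ℚ
sign b = if b then 1ℚ else - 1ℚ

-- Adding t·E with E odd to A and t to B leaves sign(A)·sign(B) unchanged:
-- both parities flip exactly when t is odd.
sign-product-shift : ∀ A B t E → par E ≡ true →
                     sign (par (A + t * E)) Q.* sign (par (B + t)) ≡ sign (par A) Q.* sign (par B)
sign-product-shift A B t E E-odd
  rewrite par-+ A (t * E) | par-+ B t | par-* t E | E-odd = lem (par A) (par B) (par t)
  where
    lem : ∀ a b c → sign (a xor (c ∧ true)) Q.* sign (b xor c) ≡ sign a Q.* sign b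
    lem true true false = refl
    lem true false false = refl
    lem false true false = refl
    lem false false false = refl
    lem true true true = refl
    lem true false true = refl
    lem false true true = refl
    lem false false true = refl

Vec² : Set
Vec² = Vtx → Vtx → ℚ

zeros : ∀ {A : Set} → List A → List ℚ
zeros xs = map (λ _ → 0ℚ) xs

unit : ∀ {A : Set} (xs : List A) → Fin (length xs) → ℚ → List ℚ
unit (x ∷ xs) F.zero c = c ∷ zeros xs
unit (x ∷ xs) (F.suc i) c = 0ℚ ∷ unit xs i c

length-zeros : ∀ {A B : Set} (g : A → B) xs → length (zeros xs) ≡ length (map g xs)
length-zeros g [] = refl
length-zeros g (x ∷ xs) = cong suc (length-zeros g xs)

length-unit : ∀ {A B : Set} (g : A → B) xs i c → length (unit xs i c) ≡ length (map g xs)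
length-unit g (x ∷ xs) F.zero c = cong suc (length-zeros g xs)
length-unit g (x ∷ xs) (F.suc i) c = cong suc (length-unit g xs i c)

0*+ : ∀ a b → 0ℚ Q.* a Q.+ b ≡ b
0*+ a b = trans (cong (Q._+ b) (QP.*-zeroˡ a)) (QP.+-identityˡ b)

lincomb-zeros : ∀ {A : Set} (g : A → Vec²) xs u v → lincomb (zeros xs) (map g xs) u v ≡ 0ℚ
lincomb-zeros g [] u v = refl
lincomb-zeros g (x ∷ xs) u v = trans (0*+ (g x u v) _) (lincomb-zeros g xs u v)

lincomb-unit : ∀ {A : Set} (g : A → Vec²) xs i c u v →
               lincomb (unit xs i c) (map g xs) u v ≡ c Q.* g (lookup xs i) u v
lincomb-unit g (x ∷ xs) F.zero c u v = trans (cong (c Q.* g x u v Q.+_) (lincomb-zeros g xs u v)) (QP.+-identityʳ _)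
lincomb-unit g (x ∷ xs) (F.suc i) c u v = trans (0*+ (g x u v) _) (lincomb-unit g xs i c u v)

LinIndep-tail : ∀ w ws → LinIndep (w ∷ ws) → LinIndep ws
LinIndep-tail w ws li cs len eq with li (0ℚ ∷ cs) (cong suc len) (λ u v → trans (0*+ (w u v) _) (eq u v))
... | _ ∷ rest = rest

-- If entries i < j of the family coincide, then 1·wᵢ - 1·wⱼ = 0 is a nontrivial relation.
LinIndep-no-repeat : ∀ {A : Set} (g : A → Vec²) xs (i j : Fin (length xs)) → i F.< j →
                     (∀ u v → g (lookup xs i) u v ≡ g (lookup xs j) u v) → LinIndep (map g xs) → ⊥
LinIndep-no-repeat g (x ∷ xs) F.zero (F.suc j) _ same li
  with li (1ℚ ∷ unit xs j (- 1ℚ)) (cong suc (length-unit g xs j (- 1ℚ))) cancels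
  where
    cancels : ∀ u v → lincomb (1ℚ ∷ unit xs j (- 1ℚ)) (map g (x ∷ xs)) u v ≡ 0ℚ
    cancels u v = begin
        1ℚ Q.* g x u v Q.+ lincomb (unit xs j (- 1ℚ)) (map g xs) u v
          ≡⟨ cong₂ (λ a b → 1ℚ Q.* a Q.+ b) (same u v) (lincomb-unit g xs j (- 1ℚ) u v) ⟩
        1ℚ Q.* w Q.+ - 1ℚ Q.* w ≡⟨ cong (1ℚ Q.* w Q.+_) (sym (QP.neg-distribˡ-* 1ℚ w)) ⟩
        1ℚ Q.* w Q.+ - (1ℚ Q.* w) ≡⟨ QP.+-inverseʳ (1ℚ Q.* w) ⟩
        0ℚ ∎
      where
        open ≡-Reasoning
        w = g (lookup xs j) u v
... | () ∷ _
LinIndep-no-repeat g (x ∷ xs) (F.suc i) (F.suc j) (s≤s i<j) same li =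
  LinIndep-no-repeat g xs i j i<j same (LinIndep-tail (g x) (map g xs) li)

LinIndep-key-bound : ∀ {A : Set} (g : A → Vec²) (key : A → ℕ) b → (∀ x → key x < b) →
                     (∀ x y → key x ≡ key y → ∀ u v → g x u v ≡ g y u v) →
                     ∀ xs → LinIndep (map g xs) → length xs ≤ b
LinIndep-key-bound g key b key<b collide xs independent = ≮⇒≥ too-many
  where
    boundedKey : Fin (length xs) → Fin b
    boundedKey k = F.fromℕ< (key<b (lookup xs k))
    too-many : b < length xs → ⊥
    too-many b<len = LinIndep-no-repeat g xs i j i<j (collide (lookup xs i) (lookup xs j) same-key) independent
      where
        collision : Σ (Fin (length xs)) λ i → Σ (Fin (length xs)) λ j → i F.< j × boundedKey i ≡ boundedKey j
        collision = pigeonhole b<len boundedKey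
        i j : Fin (length xs)
        i = proj₁ collision
        j = proj₁ (proj₂ collision)
        i<j : i F.< j
        i<j = proj₁ (proj₂ (proj₂ collision))
        same-key : key (lookup xs i) ≡ key (lookup xs j)
        same-key = trans (sym (toℕ-fromℕ< (key<b (lookup xs i))))
                     (trans (cong toℕ (proj₂ (proj₂ (proj₂ collision)))) (toℕ-fromℕ< (key<b (lookup xs j))))

T⇒≡true : ∀ {b} → T b → b ≡ true
T⇒≡true {true} _ = refl

≡true⇒T : ∀ {b} → b ≡ true → T b
≡true⇒T refl = _

∧-trueˡ : ∀ {a b} → (a ∧ b) ≡ true → a ≡ true
∧-trueˡ {true} _ = refl

∧-trueʳ : ∀ {a b} → (a ∧ b) ≡ true → b ≡ true
∧-trueʳ {true} e = e

==⇒≡ : ∀ x y → (x == y) ≡ true → x ≡ y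
==⇒≡ (a , b) (c , e) eq =
  cong₂ _,_ (≡ᵇ⇒≡ a c (≡true⇒T (∧-trueˡ eq))) (≡ᵇ⇒≡ b e (≡true⇒T (∧-trueʳ {a ≡ᵇ c} eq)))

==-refl : ∀ x → (x == x) ≡ true
==-refl (a , b) rewrite T⇒≡true (≡⇒≡ᵇ a a refl) | T⇒≡true (≡⇒≡ᵇ b b refl) = refl

not-true : ∀ {b} → (b ≡ true → ⊥) → b ≡ false
not-true {true} b≢true = ⊥-elim (b≢true refl)
not-true {false} _ = refl

≢⇒==false : ∀ x y → (x ≡ y → ⊥) → (x == y) ≡ false
≢⇒==false x y x≢y = not-true (λ e → x≢y (==⇒≡ x y e))

modP≡% : ∀ i m .{{_ : NonZero m}} → modP i m ≡ i % m
modP≡% i (suc m) = refl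

%-congruent⇒multiple : ∀ a b m .{{_ : NonZero m}} → a % m ≡ b % m → a ≤ b → Σ ℕ λ t → b ≡ a + t * m
%-congruent⇒multiple a b m a≡b a≤b = (b / m ∸ a / m) , (begin
    b                                       ≡⟨ m≡m%n+[m/n]*n b m ⟩
    b % m + (b / m) * m                     ≡⟨ cong₂ (λ x y → x + y * m) (sym a≡b) (sym (m+[n∸m]≡n (/-monoˡ-≤ m a≤b))) ⟩
    a % m + (a / m + (b / m ∸ a / m)) * m   ≡⟨ regroup (a % m) (a / m) (b / m ∸ a / m) m ⟩
    (a % m + (a / m) * m) + (b / m ∸ a / m) * m ≡⟨ cong (_+ (b / m ∸ a / m) * m) (sym (m≡m%n+[m/n]*n a m)) ⟩
    a + (b / m ∸ a / m) * m                 ∎)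
  where
    open ≡-Reasoning
    regroup : ∀ x y z w → x + (y + z) * w ≡ (x + y * w) + z * w
    regroup = solve-∀

too-far : ∀ {a b i i'} → i < a → a + a ≤ b → a + i ≡ b + i' → ⊥
too-far {a} {b} {i} {i'} i<a 2a≤b eq = <-irrefl refl (begin-strict
    a + i  <⟨ +-monoʳ-< a i<a ⟩
    a + a  ≤⟨ 2a≤b ⟩
    b      ≤⟨ m≤m+n b i' ⟩
    b + i' ≡⟨ sym eq ⟩
    a + i  ∎)
  where open ≤-Reasoning

-- The construction for a fixed n with d = dP n = suc d' > 0 and ⌊n^0.1⌋ = root10 n = suc R' > 0.
-- Position p = b·d + r of H (0-indexed, 0 ≤ r < d) carries the vertex v_{r+1, (b+1) mod N_{r+1}};
-- its vertex recurs exactly every N_{r+1}·d positions.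
module Construction (n d' R' : ℕ) (d≡ : dP n ≡ suc d') (R≡ : root10 n ≡ suc R') where

  d : ℕ
  d = suc d'

  NP-nonZero : ∀ k → NonZero (NP n k)
  NP-nonZero k = subst NonZero (sym (cong (_* 3 ^ (k ∸ 1)) R≡))
                   (m*n≢0 (suc R') (3 ^ (k ∸ 1)) {{_}} {{m^n≢0 3 (k ∸ 1)}})

  NP1≡ : NP n 1 ≡ suc R'
  NP1≡ = trans (*-identityʳ (root10 n)) R≡

  layer : ℕ → ℕ
  layer p = suc (p % d)

  vertexAt : ℕ → Vtx
  vertexAt p = (layer p , modP (suc (p / d)) (NP n (layer p)))

  -- the distance to the next occurrence of vertexAt p
  period : ℕ → ℕ
  period p = NP n (layer p) * d

  period-positive : ∀ p → Σ ℕ λ w → period p ≡ suc w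
  period-positive p with NP n (layer p) | NP-nonZero (layer p)
  ... | suc m | _ = (d' + m * d) , refl

  %-shift : ∀ p c M → (p + c * (M * d)) % d ≡ p % d
  %-shift p c M = trans (cong (λ z → (p + z) % d) (sym (*-assoc c M d))) ([m+kn]%n≡m%n p (c * M) d)

  /-shift : ∀ p c M → (p + c * (M * d)) / d ≡ p / d + c * M
  /-shift p c M = trans (cong (λ z → (p + z) / d) (sym (*-assoc c M d)))
                    (trans (+-distrib-/-∣ʳ p (divides (c * M) refl)) (cong (p / d +_) (m*n/n≡m (c * M) d)))

  layer-shift : ∀ p c M → layer (p + c * (M * d)) ≡ layer p
  layer-shift p c M = cong suc (%-shift p c M)

  period-shift : ∀ p c → period (p + c * period p) ≡ period p
  period-shift p c = cong (λ k → NP n k * d) (layer-shift p c (NP n (layer p)))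

  vertexAt-shift : ∀ p c → vertexAt (p + c * period p) ≡ vertexAt p
  vertexAt-shift p c = cong₂ _,_ (layer-shift p c N)
      (trans (cong₂ (λ a k → modP (suc a) (NP n k)) (/-shift p c N) (layer-shift p c N))
        (trans (modP≡% (suc (p / d + c * N)) N)
          (trans ([m+kn]%n≡m%n (suc (p / d)) c N) (sym (modP≡% (suc (p / d)) N)))))
    where
      N = NP n (layer p)
      instance
        N-nonZero : NonZero N
        N-nonZero = NP-nonZero (layer p)

  occurrences-periodic : ∀ k i → Periodic (λ p → vertexAt p == (k , i)) (NP n k * d)
  occurrences-periodic k i p with layer p N.≟ k
  ... | yes refl = cong (_== (k , i)) (trans (cong (λ z → vertexAt (p + z)) (sym (*-identityˡ (period p))))
                                              (vertexAt-shift p 1))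
  ... | no layer≢k = trans (≢⇒==false (vertexAt (p + W)) (k , i) (λ e → layer≢k (trans (sym shifted) (cong proj₁ e))))
                          (sym (≢⇒==false (vertexAt p) (k , i) (λ e → layer≢k (cong proj₁ e))))
    where
      W = NP n k * d
      shifted : layer (p + W) ≡ layer p
      shifted = trans (cong (λ z → layer (p + z)) (sym (*-identityˡ W))) (layer-shift p 1 (NP n k))

  same-vertex⇒period-multiple : ∀ p q → vertexAt p ≡ vertexAt q → p ≤ q → Σ ℕ λ t → q ≡ p + t * period p
  same-vertex⇒period-multiple p q eq p≤q = t , (begin
      q                                   ≡⟨ m≡m%n+[m/n]*n q d ⟩
      q % d + (q / d) * d                 ≡⟨ cong₂ (λ x y → x + y * d) (sym same-%) (suc-injective blocks) ⟩
      p % d + (p / d + t * N) * d         ≡⟨ regroup (p % d) (p / d) t N d ⟩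
      (p % d + (p / d) * d) + t * (N * d) ≡⟨ cong (_+ t * period p) (sym (m≡m%n+[m/n]*n p d)) ⟩
      p + t * period p                    ∎)
    where
      open ≡-Reasoning
      N = NP n (layer p)
      instance
        N-nonZero : NonZero N
        N-nonZero = NP-nonZero (layer p)
      same-% : p % d ≡ q % d
      same-% = suc-injective (cong proj₁ eq)
      same-index : suc (p / d) % N ≡ suc (q / d) % N
      same-index = trans (sym (modP≡% (suc (p / d)) N)) (trans (cong proj₂ eq)
                     (trans (cong (λ z → modP (suc (q / d)) (NP n (suc z))) (sym same-%)) (modP≡% (suc (q / d)) N)))
      multiple : Σ ℕ λ t → suc (q / d) ≡ suc (p / d) + t * N
      multiple = %-congruent⇒multiple (suc (p / d)) (suc (q / d)) N same-index (s≤s (/-monoˡ-≤ d p≤q))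
      t = proj₁ multiple
      blocks : suc (q / d) ≡ suc (p / d) + t * N
      blocks = proj₂ multiple
      regroup : ∀ x y z w v → x + (y + z * w) * v ≡ (x + y * v) + z * (w * v)
      regroup = solve-∀

  no-repeat-within-period : ∀ p₀ p → p₀ < p → p < p₀ + period p₀ → vertexAt p₀ ≡ vertexAt p → ⊥
  no-repeat-within-period p₀ p p₀<p p< same = by-multiple (proj₁ multiple) (proj₂ multiple)
    where
      multiple : Σ ℕ λ t → p ≡ p₀ + t * period p₀
      multiple = same-vertex⇒period-multiple p₀ p same (<⇒≤ p₀<p)
      by-multiple : ∀ t → p ≡ p₀ + t * period p₀ → ⊥
      by-multiple zero p≡ = <-irrefl (trans (sym (+-identityʳ p₀)) (sym p≡)) p₀<p
      by-multiple (suc t) p≡ = <-irrefl refl (<-≤-trans p< (subst (p₀ + period p₀ ≤_) (sym p≡)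
                                 (+-monoʳ-≤ p₀ (m≤m+n (period p₀) (t * period p₀)))))

  one-per-period : ∀ p₀ a → countR (λ p → vertexAt p == vertexAt p₀) a (period p₀) ≡ 1
  one-per-period p₀ a = trans (countR-window per a) (trans (sym (countR-window per p₀)) from-p₀)
    where
      occ = λ p → vertexAt p == vertexAt p₀
      per : Periodic occ (period p₀)
      per = occurrences-periodic (layer p₀) (proj₂ (vertexAt p₀))
      w = proj₁ (period-positive p₀)
      w≡ : period p₀ ≡ suc w
      w≡ = proj₂ (period-positive p₀)
      none : ∀ p → p₀ < p → p < p₀ + suc w → occ p ≡ false
      none p p₀<p p< = not-true (λ e → no-repeat-within-period p₀ p p₀<p (subst (λ m → p < p₀ + m) (sym w≡) p<)
                                         (sym (==⇒≡ (vertexAt p) (vertexAt p₀) e)))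
      from-p₀ : countR occ p₀ (period p₀) ≡ 1
      from-p₀ = subst (λ m → countR occ p₀ m ≡ 1) (sym w≡) (countR-single occ p₀ w (==-refl (vertexAt p₀)) none)

  V₁-occurs : ∀ j → j < NP n 1 → Σ ℕ λ p → vertexAt p ≡ (1 , j)
  V₁-occurs j j<N₁ = (b * d) , (begin
      vertexAt (b * d)               ≡⟨ cong₂ (λ x y → (suc x , modP (suc y) (NP n (suc x)))) (m*n%n≡0 b d) (m*n/n≡m b d) ⟩
      (1 , modP (suc b) (NP n 1))    ≡⟨ cong (λ z → (1 , modP (suc b) z)) NP1≡ ⟩
      (1 , suc b % suc R')           ≡⟨ cong (1 ,_) (block-for-correct j (subst (j <_) NP1≡ j<N₁)) ⟩
      (1 , j)                        ∎)
    where
      open ≡-Reasoning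
      -- the block index b with (b+1) mod N₁ = j
      block-for : ℕ → ℕ
      block-for zero = R'
      block-for (suc j') = j'
      b = block-for j
      block-for-correct : ∀ j → j < suc R' → suc (block-for j) % suc R' ≡ j
      block-for-correct zero _ = n%n≡0 (suc R')
      block-for-correct (suc j') j<N = m<n⇒m%n≡m j<N

  block≡ : ∀ a → block n (suc a) ≡ map vertexAt (range (a * d) d)
  block≡ a = begin
      map vk (map suc (upTo (dP n))) ≡⟨ cong (λ z → map vk (map suc (upTo z))) d≡ ⟩
      map vk (map suc (upTo d))      ≡⟨ cong (λ z → map vk (map suc z)) (upTo≡range d) ⟩
      map vk (map suc (range 0 d))   ≡⟨ cong (map vk) (map-suc-range 0 d) ⟩
      map vk (range 1 d)             ≡⟨ map-range-cong vk vertexAt 1 (a * d) d pointwise ⟩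
      map vertexAt (range (a * d) d) ∎
    where
      open ≡-Reasoning
      vk : ℕ → Vtx
      vk k = (k , modP (suc a) (NP n k))
      pointwise : ∀ r → r < d → vk (1 + r) ≡ vertexAt (a * d + r)
      pointwise r r<d = sym (cong₂ (λ x y → (suc x , modP (suc y) (NP n (suc x)))) rem quot)
        where
          rem : (a * d + r) % d ≡ r
          rem = trans (cong (_% d) (+-comm (a * d) r)) (trans ([m+kn]%n≡m%n r a d) (m<n⇒m%n≡m r<d))
          quot : (a * d + r) / d ≡ a
          quot = trans (+-distrib-/-∣ˡ r (divides a refl)) (trans (cong₂ _+_ (m*n/n≡m a d) (m<n⇒m/n≡0 r<d)) (+-identityʳ a))

  blocks≡ : ∀ a m → concat (map (block n) (range (suc a) m)) ≡ map vertexAt (range (a * d) (m * d))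
  blocks≡ a zero = refl
  blocks≡ a (suc m) = begin
      block n (suc a) ++ concat (map (block n) (range (suc (suc a)) m))
        ≡⟨ cong₂ _++_ (block≡ a) (blocks≡ (suc a) m) ⟩
      map vertexAt (range (a * d) d) ++ map vertexAt (range (d + a * d) (m * d))
        ≡⟨ cong (λ z → map vertexAt (range (a * d) d) ++ map vertexAt (range z (m * d))) (+-comm d (a * d)) ⟩
      map vertexAt (range (a * d) d) ++ map vertexAt (range (a * d + d) (m * d))
        ≡⟨ sym (map-++ vertexAt (range (a * d) d) (range (a * d + d) (m * d))) ⟩
      map vertexAt (range (a * d) d ++ range (a * d + d) (m * d))
        ≡⟨ cong (map vertexAt) (sym (range-++ (a * d) d (m * d))) ⟩
      map vertexAt (range (a * d) (d + m * d)) ∎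
    where open ≡-Reasoning

  H≡ : H n ≡ map vertexAt (range 0 (nBlocks n * d))
  H≡ = trans (cong (λ z → concat (map (block n) z)) (trans (cong (map suc) (upTo≡range (nBlocks n))) (map-suc-range 0 (nBlocks n))))
             (blocks≡ 0 (nBlocks n))

  substring≡ : ∀ s ℓ → s + ℓ ≤ length (H n) → take ℓ (drop s (H n)) ≡ map vertexAt (range s ℓ)
  substring≡ s ℓ s+ℓ≤ rewrite H≡ =
    trans (cong (take ℓ) (drop-map-range vertexAt 0 M s))
          (take-map-range vertexAt s (M ∸ s) ℓ
            (m+n≤o⇒m≤o∸n ℓ (subst (_≤ M) (+-comm s ℓ) (subst (s + ℓ ≤_) (length-map-range vertexAt 0 M) s+ℓ≤))))
    where M = nBlocks n * d

  period≡ : ∀ P t → t * period P ≡ (t * 3 ^ (P % d)) * (NP n 1 * d)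
  period≡ P t = regroup t (root10 n) (3 ^ (P % d)) d
    where
      regroup : ∀ t R E d → t * ((R * E) * d) ≡ (t * E) * ((R * 1) * d)
      regroup = solve-∀

  V₁-count : ∀ j → j < NP n 1 → ∀ c a → countR (λ p → vertexAt p == (1 , j)) a (c * (NP n 1 * d)) ≡ c
  V₁-count j j<N₁ c a with V₁-occurs j j<N₁
  ... | p₀ , p₀↦j = subst (λ x → countR (λ p → vertexAt p == x) a (c * (NP n 1 * d)) ≡ c) p₀↦j
        (subst (λ w → countR (λ p → vertexAt p == vertexAt p₀) a (c * w) ≡ c) period-p₀
          (countR-windows _ (period p₀) (one-per-period p₀) c a))
    where
      period-p₀ : period p₀ ≡ NP n 1 * d
      period-p₀ = cong (λ k → NP n k * d) (cong proj₁ p₀↦j)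

  -- The improvement vector of an arc at node x, with interior `mid` and prefix `pre`
  -- (impVec unfolds to exactly this).
  improvement : Vtx → List Vtx → List Vtx → Vec²
  improvement x mid pre u v =
    if isEdge n u v
    then (if (x == u) ∧ odd (countB (_== v) mid) then two Q.* (γ pre u Q.* γ pre v)
          else if (x == v) ∧ odd (countB (_== u) mid) then two Q.* (γ pre u Q.* γ pre v)
          else 0ℚ)
    else 0ℚ

  -- The improvement vector of the arc from position P to P + period P, in the string starting at s.
  arcVector : ℕ → ℕ → Vec²
  arcVector s P = improvement (vertexAt P) (map vertexAt (range (suc P) (period P ∸ 1))) (map vertexAt (range s (P ∸ s)))

  edge-source : ∀ uk ui v → isEdge n (uk , ui) v ≡ true → uk ≡ 1 × ui < NP n 1
  edge-source uk ui (vk , vi) e =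
    ≡ᵇ⇒≡ uk 1 (≡true⇒T (∧-trueˡ {uk ≡ᵇ 1} e)) ,
    ≤ᵇ⇒≤ (suc ui) (NP n 1) (≡true⇒T (∧-trueˡ {suc ui ≤ᵇ NP n 1} (∧-trueʳ {uk ≡ᵇ 1} e)))

  V₁-count-shift : ∀ j P t a m → countB (_== (1 , j)) (map vertexAt (range (a + t * period P) m))
                                ≡ countB (_== (1 , j)) (map vertexAt (range a m))
  V₁-count-shift j P t a m = begin
      countB (_== (1 , j)) (map vertexAt (range (a + t * period P) m))
        ≡⟨ countB-map (_== (1 , j)) vertexAt (range (a + t * period P) m) ⟩
      countR occ (a + t * period P) m
        ≡⟨ cong (λ z → countR occ (a + z) m) (period≡ P t) ⟩
      countR occ (a + (t * 3 ^ (P % d)) * (NP n 1 * d)) m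
        ≡⟨ countR-shift (periodic-multiple (occurrences-periodic 1 j) (t * 3 ^ (P % d))) a m ⟩
      countR occ a m
        ≡⟨ sym (countB-map (_== (1 , j)) vertexAt (range a m)) ⟩
      countB (_== (1 , j)) (map vertexAt (range a m)) ∎
    where
      open ≡-Reasoning
      occ = λ p → vertexAt p == (1 , j)

  prefix-count : ∀ (f : Vtx → Bool) s P X → s ≤ P →
                 countB f (map vertexAt (range s (P + X ∸ s)))
                 ≡ countR (λ p → f (vertexAt p)) s (P ∸ s) + countR (λ p → f (vertexAt p)) P X
  prefix-count f s P X s≤P = begin
      countB f (map vertexAt (range s (P + X ∸ s))) ≡⟨ countB-map f vertexAt (range s (P + X ∸ s)) ⟩
      countR g s (P + X ∸ s)                    ≡⟨ cong (countR g s) (+-∸-comm X s≤P) ⟩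
      countR g s (P ∸ s + X)                    ≡⟨ countR-++ g s (P ∸ s) X ⟩
      countR g s (P ∸ s) + countR g (s + (P ∸ s)) X ≡⟨ cong (λ z → countR g s (P ∸ s) + countR g z X) (m+[n∸m]≡n s≤P) ⟩
      countR g s (P ∸ s) + countR g P X         ∎
    where
      open ≡-Reasoning
      g = λ p → f (vertexAt p)

  -- Moving the start of an arc by t periods adds t·3^{k-1} occurrences of any u ∈ V_1 and t occurrences
  -- of the arc's own node to the prefix; as 3^{k-1} is odd, the sign γ(u)·γ(x) is unchanged.
  prefix-sign-shift : ∀ s P t j → j < NP n 1 → s ≤ P →
      let pre = map vertexAt (range s (P ∸ s)); pre' = map vertexAt (range s (P + t * period P ∸ s)) in
      γ pre (1 , j) Q.* γ pre (vertexAt P) ≡ γ pre' (1 , j) Q.* γ pre' (vertexAt P)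
  prefix-sign-shift s P t j j<N₁ s≤P = begin
      sign (odd (countB (_== u) pre)) Q.* sign (odd (countB (_== x) pre))
        ≡⟨ cong₂ (λ a b → sign a Q.* sign b) (trans (cong odd (countB-map (_== u) vertexAt (range s (P ∸ s)))) (odd≡par A))
                                             (trans (cong odd (countB-map (_== x) vertexAt (range s (P ∸ s)))) (odd≡par B)) ⟩
      sign (par A) Q.* sign (par B)
        ≡⟨ sym (sign-product-shift A B t (3 ^ (P % d)) (par-3^ (P % d))) ⟩
      sign (par (A + t * 3 ^ (P % d))) Q.* sign (par (B + t))
        ≡⟨ sym (cong₂ (λ a b → sign a Q.* sign b) (trans (cong odd count-u) (odd≡par (A + t * 3 ^ (P % d))))
                                                 (trans (cong odd count-x) (odd≡par (B + t)))) ⟩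
      sign (odd (countB (_== u) pre')) Q.* sign (odd (countB (_== x) pre')) ∎
    where
      open ≡-Reasoning
      u = (1 , j)
      x = vertexAt P
      pre = map vertexAt (range s (P ∸ s))
      pre' = map vertexAt (range s (P + t * period P ∸ s))
      A = countR (λ p → vertexAt p == u) s (P ∸ s)
      B = countR (λ p → vertexAt p == x) s (P ∸ s)
      count-u : countB (_== u) pre' ≡ A + t * 3 ^ (P % d)
      count-u = trans (prefix-count (_== u) s P (t * period P) s≤P)
                  (cong (A +_) (trans (cong (countR (λ p → vertexAt p == u) P) (period≡ P t))
                                      (V₁-count j j<N₁ (t * 3 ^ (P % d)) P)))
      count-x : countB (_== x) pre' ≡ B + t
      count-x = trans (prefix-count (_== x) s P (t * period P) s≤P)
                  (cong (B +_) (countR-windows (λ p → vertexAt p == x) (period P) (one-per-period P) t P))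

  -- For a node x outside V_1, moving the arc by t periods keeps its improvement vector: every edge
  -- coordinate (u , v) has u ∈ V_1, so u ≠ x, the interior count of u is periodic, and γ(u)·γ(x) is
  -- invariant by prefix-sign-shift.
  improvement-shift : ∀ s P t → (P % d ≡ 0 → ⊥) → s ≤ P → ∀ u v →
      improvement (vertexAt P) (map vertexAt (range (suc P) (period P ∸ 1))) (map vertexAt (range s (P ∸ s))) u v
      ≡ improvement (vertexAt P) (map vertexAt (range (suc (P + t * period P)) (period P ∸ 1)))
                                 (map vertexAt (range s (P + t * period P ∸ s))) u v
  improvement-shift s P t P∉V₁ s≤P (uk , j) v with isEdge n (uk , j) v in edge
  ... | false = refl
  ... | true with edge-source uk j v edge
  ...   | refl , j<N₁ rewrite ≢⇒==false (vertexAt P) (1 , j) (λ e → P∉V₁ (suc-injective (cong proj₁ e)))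
                            | V₁-count-shift j P t (suc P) (period P ∸ 1)
                            with vertexAt P == v in x≟v
  ...     | false = refl
  ...     | true = cong (λ z → if true ∧ odd (countB (_== (1 , j)) mid) then z else 0ℚ)
                        (cong (two Q.*_) (subst (λ w → γ pre (1 , j) Q.* γ pre w ≡ γ pre' (1 , j) Q.* γ pre' w)
                                                (==⇒≡ (vertexAt P) v x≟v) (prefix-sign-shift s P t j j<N₁ s≤P)))
    where
      mid = map vertexAt (range (suc P) (period P ∸ 1))
      pre = map vertexAt (range s (P ∸ s))
      pre' = map vertexAt (range s (P + t * period P ∸ s))

  arcVector-shift : ∀ s P t → (P % d ≡ 0 → ⊥) → s ≤ P →
                    ∀ u v → arcVector s P u v ≡ arcVector s (P + t * period P) u v
  arcVector-shift s P t P∉V₁ s≤P u v = trans (improvement-shift s P t P∉V₁ s≤P u v) (sym moved)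
    where
      P' = P + t * period P
      moved : arcVector s P' u v ≡ improvement (vertexAt P) (map vertexAt (range (suc P') (period P ∸ 1)))
                                                (map vertexAt (range s (P' ∸ s))) u v
      moved = cong₂ (λ x w → improvement x (map vertexAt (range (suc P') (w ∸ 1))) (map vertexAt (range s (P' ∸ s))) u v)
                    (vertexAt-shift P t) (period-shift P t)

  same-node-vector : ∀ s P P' → s ≤ P → s ≤ P' → (P % d ≡ 0 → ⊥) → vertexAt P ≡ vertexAt P' →
                     ∀ u v → arcVector s P u v ≡ arcVector s P' u v
  same-node-vector s P P' s≤P s≤P' P∉V₁ same u v = by-order (≤-total P P')
    where
      P'∉V₁ : P' % d ≡ 0 → ⊥
      P'∉V₁ e = P∉V₁ (trans (suc-injective (cong proj₁ same)) e)
      shifted : ∀ Q Q' → s ≤ Q → (Q % d ≡ 0 → ⊥) → vertexAt Q ≡ vertexAt Q' → Q ≤ Q' →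
                arcVector s Q u v ≡ arcVector s Q' u v
      shifted Q Q' s≤Q Q∉V₁ same′ Q≤Q' =
        trans (arcVector-shift s Q (proj₁ multiple) Q∉V₁ s≤Q u v) (cong (λ z → arcVector s z u v) (sym (proj₂ multiple)))
        where
          multiple : Σ ℕ λ t → Q' ≡ Q + t * period Q
          multiple = same-vertex⇒period-multiple Q Q' same′ Q≤Q'
      by-order : P ≤ P' ⊎ P' ≤ P → arcVector s P u v ≡ arcVector s P' u v
      by-order (inj₁ P≤P') = shifted P P' s≤P P∉V₁ same P≤P'
      by-order (inj₂ P'≤P) = sym (shifted P' P s≤P' P'∉V₁ (sym same) P'≤P)

  NP-double : ∀ r r' → r < r' → NP n (suc r) + NP n (suc r) ≤ NP n (suc r')
  NP-double r r' r<r' = begin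
      R * X + R * X       ≤⟨ m≤m+n (R * X + R * X) (R * X) ⟩
      R * X + R * X + R * X ≡⟨ regroup R X ⟩
      R * (3 ^ suc r)     ≤⟨ *-monoʳ-≤ R (^-monoʳ-≤ 3 r<r') ⟩
      R * (3 ^ r')        ∎
    where
      open ≤-Reasoning
      R = root10 n
      X = 3 ^ r
      regroup : ∀ R X → R * X + R * X + R * X ≡ R * (3 * X)
      regroup = solve-∀

  -- The code N_k + i (i < N_k) of a vertex v_{k,i} lies in [N_k, 2N_k); these intervals are disjoint,
  -- so the code determines the layer.
  code-layer : ∀ r r' i i' → i < NP n (suc r) → i' < NP n (suc r') → NP n (suc r) + i ≡ NP n (suc r') + i' → r ≡ r'
  code-layer r r' i i' i< i'< eq with <-cmp r r'
  ... | tri< r<r' _ _ = ⊥-elim (too-far i< (NP-double r r' r<r') eq)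
  ... | tri≈ _ r≡r' _ = r≡r'
  ... | tri> _ _ r'<r = ⊥-elim (too-far i'< (NP-double r' r r'<r) (sym eq))

  module Window (s ℓ : ℕ) where

    S : List Vtx
    S = map vertexAt (range s ℓ)

    length-S : length S ≡ ℓ
    length-S = length-map-range vertexAt s ℓ

    left right : Arc S → ℕ
    left α = toℕ (Arc.i α)
    right α = toℕ (Arc.j α)

    right<ℓ : ∀ α → right α < ℓ
    right<ℓ α = subst (right α <_) length-S (toℕ<n (Arc.j α))

    lookup-S : ∀ q → lookup S q ≡ vertexAt (s + toℕ q)
    lookup-S = lookup-map-range vertexAt s ℓ

    no-occurrence-inside : ∀ α p → s + left α < p → p < s + right α → vertexAt p ≡ vertexAt (s + left α) → ⊥
    no-occurrence-inside α p after before same =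
        Arc.noneBetween α l (subst (left α <_) (sym l≡) i<l) (subst (_< right α) (sym l≡) l<j)
          (trans (lookup-S l) (trans (cong vertexAt s+l≡p) (trans same (sym (lookup-S (Arc.i α))))))
      where
        s≤p : s ≤ p
        s≤p = ≤-trans (m≤m+n s (left α)) (<⇒≤ after)
        l<j : p ∸ s < right α
        l<j = subst (p ∸ s <_) (m+n∸m≡n s (right α)) (∸-monoˡ-< before s≤p)
        i<l : left α < p ∸ s
        i<l = subst (_< p ∸ s) (m+n∸m≡n s (left α)) (∸-monoˡ-< after (m≤m+n s (left α)))
        l<len : p ∸ s < length S
        l<len = subst (p ∸ s <_) (sym length-S) (<-trans l<j (right<ℓ α))
        l = fromℕ< l<len
        l≡ : toℕ l ≡ p ∸ s
        l≡ = toℕ-fromℕ< l<len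
        s+l≡p : s + toℕ l ≡ p
        s+l≡p = trans (cong (s +_) l≡) (m+[n∸m]≡n s≤p)

    arc-span : ∀ α → right α ≡ left α + period (s + left α)
    arc-span α = by-multiple (proj₁ multiple) (proj₂ multiple)
      where
        P = s + left α
        same : vertexAt P ≡ vertexAt (s + right α)
        same = trans (sym (lookup-S (Arc.i α))) (trans (Arc.same α) (lookup-S (Arc.j α)))
        multiple : Σ ℕ λ t → s + right α ≡ P + t * period P
        multiple = same-vertex⇒period-multiple P (s + right α) same (+-monoʳ-≤ s (<⇒≤ (Arc.i<j α)))
        0<W : 0 < period P
        0<W = subst (0 <_) (sym (proj₂ (period-positive P))) (s≤s z≤n)
        recurs : vertexAt (P + period P) ≡ vertexAt P
        recurs = trans (cong (λ z → vertexAt (P + z)) (sym (*-identityˡ (period P)))) (vertexAt-shift P 1)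
        by-multiple : ∀ t → s + right α ≡ P + t * period P → right α ≡ left α + period P
        by-multiple zero e =
          ⊥-elim (<-irrefl (+-cancelˡ-≡ s (left α) (right α) (trans (sym (+-identityʳ P)) (sym e))) (Arc.i<j α))
        by-multiple (suc zero) e = +-cancelˡ-≡ s (right α) (left α + period P)
          (trans e (trans (cong (P +_) (+-identityʳ (period P))) (+-assoc s (left α) (period P))))
        by-multiple (suc (suc t)) e = ⊥-elim (no-occurrence-inside α (P + period P) (m<m+n P 0<W) before recurs)
          where
            before : P + period P < s + right α
            before = subst (P + period P <_) (sym e)
                       (+-monoʳ-< P (m<m+n (period P) (<-≤-trans 0<W (m≤m+n (period P) (t * period P)))))

    impVec≡arcVector : ∀ α u v → impVec n S α u v ≡ arcVector s (s + left α) u v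
    impVec≡arcVector α u v = cong₃ (λ x mid pre → improvement x mid pre u v) (lookup-S (Arc.i α)) mid≡ pre≡
      where
        cong₃ : ∀ {A B C D : Set} (f : A → B → C → D) {a a' b b' c c'} →
                a ≡ a' → b ≡ b' → c ≡ c' → f a b c ≡ f a' b' c'
        cong₃ f refl refl refl = refl
        P = s + left α
        mid≡ : take (right α ∸ suc (left α)) (drop (suc (left α)) S) ≡ map vertexAt (range (suc P) (period P ∸ 1))
        mid≡ = trans (cong (take (right α ∸ suc (left α))) (drop-map-range vertexAt s ℓ (suc (left α))))
                 (trans (take-map-range vertexAt (s + suc (left α)) (ℓ ∸ suc (left α)) (right α ∸ suc (left α))
                           (∸-monoˡ-≤ (suc (left α)) (<⇒≤ (right<ℓ α))))
                   (cong₂ (λ a b → map vertexAt (range a b)) (+-suc s (left α))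
                     (trans (cong (_∸ suc (left α)) (arc-span α)) (span∸ (left α) _))))
          where
            span∸ : ∀ a w → a + w ∸ suc a ≡ w ∸ 1
            span∸ zero w = refl
            span∸ (suc a) w = span∸ a w
        pre≡ : take (left α) S ≡ map vertexAt (range s (P ∸ s))
        pre≡ = trans (take-map-range vertexAt s ℓ (left α) (<⇒≤ (<-trans (Arc.i<j α) (right<ℓ α))))
                     (cong (λ z → map vertexAt (range s z)) (sym (m+n∸m≡n s (left α))))

    q : ℕ
    q = ℓ / d

    ℓ<[1+q]d : ℓ < suc q * d
    ℓ<[1+q]d = begin-strict
        ℓ             ≡⟨ m≡m%n+[m/n]*n ℓ d ⟩
        ℓ % d + q * d <⟨ +-monoˡ-< (q * d) (m%n<n ℓ d) ⟩
        d + q * d     ∎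
      where open ≤-Reasoning

    NP≤q : ∀ P → period P < ℓ → NP n (layer P) ≤ q
    NP≤q P period<ℓ = ≤-pred (*-cancelʳ-< d (NP n (layer P)) (suc q) (<-trans period<ℓ ℓ<[1+q]d))

    index : ℕ → ℕ → ℕ
    index P k = modP (suc (P / d)) (NP n k)

    index<NP : ∀ P k → index P k < NP n k
    index<NP P k = subst (_< NP n k) (sym (modP≡% (suc (P / d)) (NP n k) {{NP-nonZero k}}))
                         (m%n<n (suc (P / d)) (NP n k) {{NP-nonZero k}})

    -- code P r for a position P with P % d ≡ r: for V_1 (r = 0) the block of P relative to that of s,
    -- shifted past 2(q+1); otherwise the code N_k + i of the node v_{k,i} at P.
    code : ℕ → ℕ → ℕ
    code P zero = 2 * suc q + (P / d ∸ s / d)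
    code P (suc r) = NP n (suc (suc r)) + index P (suc (suc r))

    key : ℕ → ℕ
    key P = code P (P % d)

    -- Codes of nodes outside V_1 stay below 2(q + 1), where the codes of V_1 positions begin.

    code-other< : ∀ P r → P % d ≡ suc r → period P < ℓ → code P (suc r) < 2 * suc q
    code-other< P r P%d≡ period<ℓ = begin-strict
        N + index P (suc (suc r)) <⟨ +-monoʳ-< N (index<NP P (suc (suc r))) ⟩
        N + N                    ≤⟨ +-mono-≤ N≤q N≤q ⟩
        q + q                    ≤⟨ +-mono-≤ (n≤1+n q) (≤-trans (n≤1+n q) (m≤m+n (suc q) 0)) ⟩
        2 * suc q                ∎
      where
        open ≤-Reasoning
        N = NP n (suc (suc r))
        N≤q : N ≤ q
        N≤q = subst (λ z → NP n (suc z) ≤ q) P%d≡ (NP≤q P period<ℓ)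

    -- A position P of S lies in one of the q + 2 blocks starting from that of s.
    code-V₁< : ∀ P → P < s + ℓ → code P 0 < 3 * q + 4
    code-V₁< P P<s+ℓ = begin-strict
        2 * suc q + (P / d ∸ s / d) <⟨ +-monoʳ-< (2 * suc q) blocks< ⟩
        2 * suc q + suc (suc q)     ≡⟨ regroup q ⟩
        3 * q + 4                   ∎
      where
        open ≤-Reasoning
        regroup : ∀ q → 2 * suc q + suc (suc q) ≡ 3 * q + 4
        regroup = solve-∀
        sd = s / d * d
        P< : P < sd + suc (suc q) * d
        P< = begin-strict
          P                         <⟨ P<s+ℓ ⟩
          s + ℓ                     ≡⟨ cong (_+ ℓ) (trans (m≡m%n+[m/n]*n s d) (+-comm (s % d) sd)) ⟩
          sd + s % d + ℓ            ≤⟨ +-monoˡ-≤ ℓ (+-monoʳ-≤ sd (<⇒≤ (m%n<n s d))) ⟩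
          sd + d + ℓ                ≤⟨ +-monoʳ-≤ (sd + d) (<⇒≤ ℓ<[1+q]d) ⟩
          sd + d + suc q * d        ≡⟨ +-assoc sd d (suc q * d) ⟩
          sd + suc (suc q) * d      ∎
        blocks< : P / d ∸ s / d < suc (suc q)
        blocks< = *-cancelʳ-< d _ _ (begin-strict
          (P / d ∸ s / d) * d ≡⟨ *-distribʳ-∸ d (P / d) (s / d) ⟩
          P / d * d ∸ sd      ≤⟨ ∸-monoˡ-≤ sd (m/n*n≤m P d) ⟩
          P ∸ sd              <⟨ m<n+o⇒m∸n<o P sd P< ⟩
          suc (suc q) * d     ∎)

    key< : ∀ P → P < s + ℓ → period P < ℓ → key P < 3 * q + 4
    key< P P<s+ℓ period<ℓ = by-layer (P % d) refl
      where
        double≤triple : ∀ q → 2 * suc q ≤ 3 * q + 4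
        double≤triple q = subst (_≤ 3 * q + 4) (sym (regroup q))
                            (+-mono-≤ (*-monoˡ-≤ q {2} {3} (s≤s (s≤s z≤n))) (s≤s (s≤s (z≤n {2}))))
          where
            regroup : ∀ q → 2 * suc q ≡ 2 * q + 2
            regroup = solve-∀
        by-layer : ∀ r → P % d ≡ r → code P r < 3 * q + 4
        by-layer zero _ = code-V₁< P P<s+ℓ
        by-layer (suc r) P%d≡ = <-≤-trans (code-other< P r P%d≡ period<ℓ) (double≤triple q)

    -- Positions with equal keys carry equal arc vectors: for V_1 the key determines the position,
    -- otherwise it determines the node.
    key-collision : ∀ P P' → s ≤ P → s ≤ P' → period P < ℓ → period P' < ℓ → key P ≡ key P' →
                    ∀ u v → arcVector s P u v ≡ arcVector s P' u v
    key-collision P P' s≤P s≤P' period<ℓ period'<ℓ = by-layer (P % d) (P' % d) refl refl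
      where
        V₁-code-large : ∀ x y → 2 * suc q + x ≡ y → y < 2 * suc q → ⊥
        V₁-code-large x y eq y< = <-irrefl refl (<-≤-trans y< (subst (2 * suc q ≤_) eq (m≤m+n (2 * suc q) x)))
        vertexAt≡ : ∀ Q r → Q % d ≡ r → vertexAt Q ≡ (suc r , index Q (suc r))
        vertexAt≡ Q r e = cong (λ z → (suc z , modP (suc (Q / d)) (NP n (suc z)))) e
        by-layer : ∀ r r' → P % d ≡ r → P' % d ≡ r' → code P r ≡ code P' r' →
                   ∀ u v → arcVector s P u v ≡ arcVector s P' u v
        by-layer zero zero e e' eq u v = cong (λ z → arcVector s z u v) P≡P'
          where
            same-block : P / d ≡ P' / d
            same-block = ∸-cancelʳ-≡ (/-monoˡ-≤ d s≤P) (/-monoˡ-≤ d s≤P')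
                           (+-cancelˡ-≡ (2 * suc q) (P / d ∸ s / d) (P' / d ∸ s / d) eq)
            P≡P' : P ≡ P'
            P≡P' = trans (m≡m%n+[m/n]*n P d)
                     (trans (cong₂ (λ a b → a + b * d) (trans e (sym e')) same-block) (sym (m≡m%n+[m/n]*n P' d)))
        by-layer zero (suc r') e e' eq =
          ⊥-elim (V₁-code-large (P / d ∸ s / d) (code P' (suc r')) eq (code-other< P' r' e' period'<ℓ))
        by-layer (suc r) zero e e' eq =
          ⊥-elim (V₁-code-large (P' / d ∸ s / d) (code P (suc r)) (sym eq) (code-other< P r e period<ℓ))
        by-layer (suc r) (suc r') e e' eq = same-node-vector s P P' s≤P s≤P' (λ z → 0≢1+n (trans (sym z) e)) same
          where
            same-layer : r ≡ r'
            same-layer = suc-injective (code-layer (suc r) (suc r') (index P (suc (suc r))) (index P' (suc (suc r')))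
                                         (index<NP P (suc (suc r))) (index<NP P' (suc (suc r'))) eq)
            same-index : index P (suc (suc r)) ≡ index P' (suc (suc r'))
            same-index = +-cancelˡ-≡ (NP n (suc (suc r))) (index P (suc (suc r))) (index P' (suc (suc r')))
                           (trans eq (cong (λ k → NP n (suc (suc k)) + index P' (suc (suc r'))) (sym same-layer)))
            same : vertexAt P ≡ vertexAt P'
            same = trans (vertexAt≡ P (suc r) e)
                     (trans (cong₂ _,_ (cong (λ k → suc (suc k)) same-layer) same-index) (sym (vertexAt≡ P' (suc r') e')))

    arc-start : Arc S → ℕ
    arc-start α = s + left α

    arc-period<ℓ : ∀ α → period (arc-start α) < ℓ
    arc-period<ℓ α = begin-strict
        period (arc-start α)            ≤⟨ m≤n+m (period (arc-start α)) (left α) ⟩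
        left α + period (arc-start α)   ≡⟨ sym (arc-span α) ⟩
        right α                         <⟨ right<ℓ α ⟩
        ℓ                               ∎
      where open ≤-Reasoning

    arc-start<s+ℓ : ∀ α → arc-start α < s + ℓ
    arc-start<s+ℓ α = +-monoʳ-< s (<-trans (Arc.i<j α) (right<ℓ α))

    arc-key : Arc S → ℕ
    arc-key α = key (arc-start α)

    arc-key< : ∀ α → arc-key α < 3 * q + 4
    arc-key< α = key< (arc-start α) (arc-start<s+ℓ α) (arc-period<ℓ α)

    arc-collision : ∀ α β → arc-key α ≡ arc-key β → ∀ u v → impVec n S α u v ≡ impVec n S β u v
    arc-collision α β equal-keys u v = begin
        impVec n S α u v              ≡⟨ impVec≡arcVector α u v ⟩
        arcVector s (arc-start α) u v ≡⟨ key-collision (arc-start α) (arc-start β) (m≤m+n s (left α)) (m≤m+n s (left β))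
                                                       (arc-period<ℓ α) (arc-period<ℓ β) equal-keys u v ⟩
        arcVector s (arc-start β) u v ≡⟨ sym (impVec≡arcVector β u v) ⟩
        impVec n S β u v              ∎
      where open ≡-Reasoning

    independent-arcs≤ : (L : List (Arc S)) → LinIndep (map (impVec n S) L) → length L ≤ 3 * q + 4
    independent-arcs≤ = LinIndep-key-bound (impVec n S) arc-key (3 * q + 4) arc-key< arc-collision

    -- Consequently rank(S)·d ≤ 7ℓ: a nonempty family contains an arc, whose span ≥ d fits into S.
    independent-arcs·d≤ : (L : List (Arc S)) → LinIndep (map (impVec n S) L) → length L * d ≤ 7 * ℓ
    independent-arcs·d≤ [] _ = z≤n
    independent-arcs·d≤ (α ∷ L) independent = begin
        length (α ∷ L) * d  ≤⟨ *-monoˡ-≤ d (independent-arcs≤ (α ∷ L) independent) ⟩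
        (3 * q + 4) * d     ≡⟨ regroup q d ⟩
        3 * (q * d) + 4 * d ≤⟨ +-mono-≤ (*-monoʳ-≤ 3 (m/n*n≤m ℓ d)) (*-monoʳ-≤ 4 (<⇒≤ d<ℓ)) ⟩
        3 * ℓ + 4 * ℓ       ≡⟨ regroup′ ℓ ⟩
        7 * ℓ               ∎
      where
        open ≤-Reasoning
        regroup : ∀ q d → (3 * q + 4) * d ≡ 3 * (q * d) + 4 * d
        regroup = solve-∀
        regroup′ : ∀ l → 3 * l + 4 * l ≡ 7 * l
        regroup′ = solve-∀
        d<ℓ : d < ℓ
        d<ℓ = ≤-<-trans (m≤n*m d (NP n (layer (arc-start α))) {{NP-nonZero (layer (arc-start α))}}) (arc-period<ℓ α)

  rank·d≤ : ∀ s ℓ → s + ℓ ≤ length (H n) → ∀ r → IsRank n (take ℓ (drop s (H n))) r → r * d ≤ 7 * ℓ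
  rank·d≤ s ℓ s+ℓ≤ r rank =
    subst (λ z → z * d ≤ 7 * ℓ) (proj₁ (proj₂ witness)) (independent-arcs·d≤ (proj₁ witness) (proj₂ (proj₂ witness)))
    where
      open Window s ℓ
      witness : Σ (List (Arc S)) λ L → length L ≡ r × LinIndep (map (impVec n S) L)
      witness = proj₁ (subst (λ S′ → IsRank n S′ r) (substring≡ s ℓ s+ℓ≤) rank)

dP≡ : ∀ n → dP n ≡ countR (λ j → 3 ^ (10 * j) ≤ᵇ n) 1 n
dP≡ n = cong (countB (λ j → 3 ^ (10 * j) ≤ᵇ n)) (trans (cong (map suc) (upTo≡range n)) (map-suc-range 0 n))

x<3^x : ∀ x → x < 3 ^ x
x<3^x zero = s≤s z≤n
x<3^x (suc x) = begin-strict
    suc x                 <⟨ +-mono-≤ (m^n>0 3 x) (x<3^x x) ⟩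
    3 ^ x + 3 ^ x         ≤⟨ m≤m+n (3 ^ x + 3 ^ x) (3 ^ x) ⟩
    3 ^ x + 3 ^ x + 3 ^ x ≡⟨ regroup (3 ^ x) ⟩
    3 * 3 ^ x             ∎
  where
    open ≤-Reasoning
    regroup : ∀ y → y + y + y ≡ 3 * y
    regroup = solve-∀

n<3^[10[1+d]] : ∀ n → n < 3 ^ (10 * suc (dP n))
n<3^[10[1+d]] n = ≰⇒> too-small
  where
    D = dP n
    p = λ j → 3 ^ (10 * j) ≤ᵇ n
    too-small : 3 ^ (10 * suc D) ≤ n → ⊥
    too-small big = <-irrefl refl (subst (D <_) (sym D≡) (m≤m+n (suc D) _))
      where
        1+D≤n : suc D ≤ n
        1+D≤n = ≤-trans (<⇒≤ (<-≤-trans (x<3^x (suc D)) (^-monoʳ-≤ 3 (m≤n*m (suc D) 10)))) big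
        all-small : ∀ j → 1 ≤ j → j < 1 + suc D → p j ≡ true
        all-small j _ j< = T⇒≡true (≤⇒≤ᵇ (≤-trans (^-monoʳ-≤ 3 (*-monoʳ-≤ 10 (≤-pred j<))) big))
        D≡ : D ≡ suc D + countR p (1 + suc D) (n ∸ suc D)
        D≡ = trans (dP≡ n) (trans (cong (countR p 1) (sym (m+[n∸m]≡n 1+D≤n)))
               (trans (countR-++ p 1 (suc D) (n ∸ suc D))
                      (cong (_+ countR p (1 + suc D) (n ∸ suc D)) (countR-all p 1 (suc D) all-small))))

-- Hence log₂ n ≤ 16 (d + 1), using 3^10 ≤ 2^16.
log₂≤16[1+d] : ∀ n → ⌊log₂ n ⌋ ≤ 16 * suc (dP n)
log₂≤16[1+d] n = begin
    ⌊log₂ n ⌋                      ≤⟨ ⌊log₂⌋-mono-≤ n≤ ⟩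
    ⌊log₂ (2 ^ (16 * suc D)) ⌋     ≡⟨ ⌊log₂[2^n]⌋≡n (16 * suc D) ⟩
    16 * suc D                     ∎
  where
    open ≤-Reasoning
    D = dP n
    n≤ : n ≤ 2 ^ (16 * suc D)
    n≤ = begin
      n                 ≤⟨ <⇒≤ (n<3^[10[1+d]] n) ⟩
      3 ^ (10 * suc D)  ≡⟨ sym (^-*-assoc 3 10 (suc D)) ⟩
      (3 ^ 10) ^ suc D  ≤⟨ ^-monoˡ-≤ (suc D) (≤ᵇ⇒≤ (3 ^ 10) (2 ^ 16) _) ⟩
      (2 ^ 16) ^ suc D  ≡⟨ ^-*-assoc 2 16 (suc D) ⟩
      2 ^ (16 * suc D)  ∎

log₂≤32d : ∀ n d' → dP n ≡ suc d' → ⌊log₂ n ⌋ ≤ 32 * suc d'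
log₂≤32d n d' d≡ = begin
    ⌊log₂ n ⌋                ≤⟨ subst (λ D → ⌊log₂ n ⌋ ≤ 16 * suc D) d≡ (log₂≤16[1+d] n) ⟩
    16 * suc (suc d')        ≤⟨ *-monoʳ-≤ 16 (s≤s (m≤n+m (suc d') d')) ⟩
    16 * (suc d' + suc d')   ≡⟨ regroup (suc d') ⟩
    32 * suc d'              ∎
  where
    open ≤-Reasoning
    regroup : ∀ e → 16 * (e + e) ≡ 32 * e
    regroup = solve-∀

dP-positive : ∀ n → 3 ^ 10 ≤ n → Σ ℕ λ d' → dP n ≡ suc d'
dP-positive (suc m) 3^10≤n =
  countR p 2 m , trans (dP≡ (suc m)) (trans (countB-∷ p 1 (range 2 m))
                                              (cong (λ b → b2n b + countR p 2 m) (T⇒≡true (≤⇒≤ᵇ 3^10≤n))))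
  where p = λ j → 3 ^ (10 * j) ≤ᵇ suc m

root10-positive : ∀ n → 1 ≤ n → Σ ℕ λ R' → root10 n ≡ suc R'
root10-positive (suc m) _ = countR p 2 m , cong (λ xs → countB p xs ∸ 1) (upTo≡range (suc (suc m)))
  where p = λ x → x ^ 10 ≤ᵇ suc m

lemmaB1 : ∃[ C ] ∃[ n₀ ] ((n : ℕ) → n₀ ≤ n → (s ℓ : ℕ) → s + ℓ ≤ length (H n) →
    (r : ℕ) → IsRank n (take ℓ (drop s (H n))) r → r * ⌊log₂ n ⌋ ≤ C * ℓ)
lemmaB1 = 224 , 3 ^ 10 , rank·log≤
  where
    rank·log≤ : (n : ℕ) → 3 ^ 10 ≤ n → (s ℓ : ℕ) → s + ℓ ≤ length (H n) →
                (r : ℕ) → IsRank n (take ℓ (drop s (H n))) r → r * ⌊log₂ n ⌋ ≤ 224 * ℓ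
    rank·log≤ n n≥ s ℓ s+ℓ≤ r rank = begin
        r * ⌊log₂ n ⌋      ≤⟨ *-monoʳ-≤ r (log₂≤32d n d' d≡) ⟩
        r * (32 * suc d')  ≡⟨ regroup r (suc d') ⟩
        32 * (r * suc d')  ≤⟨ *-monoʳ-≤ 32 (Construction.rank·d≤ n d' R' d≡ R≡ s ℓ s+ℓ≤ r rank) ⟩
        32 * (7 * ℓ)       ≡⟨ sym (*-assoc 32 7 ℓ) ⟩
        224 * ℓ            ∎
      where
        open ≤-Reasoning
        d' : ℕ
        d' = proj₁ (dP-positive n n≥)
        d≡ : dP n ≡ suc d'
        d≡ = proj₂ (dP-positive n n≥)
        R' : ℕ
        R' = proj₁ (root10-positive n (≤-trans (s≤s z≤n) n≥))
        R≡ : root10 n ≡ suc R'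
        R≡ = proj₂ (root10-positive n (≤-trans (s≤s z≤n) n≥))
        regroup : ∀ r e → r * (32 * e) ≡ 32 * (r * e)
        regroup = solve-∀
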